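{- Let $k\ge 2$ and $n\in\mathbb{N}$, and let $w,w'\in S_n$. Then the stable configuration $\mathcal{C}_{k,n,w}$ is lexicographically earlier than $\mathcal{C}_{k,n,w'}$ if and only if $B(w)$ is lexicographically earlier than $B(w')$.
   Context: The infinite rooted directed $k$-ary tree has a root on layer $1$; every vertex has $k$ children, ordered left to right, on the next layer. A vertex with at least $k$ chips may fire by choosing $k$ of its labeled chips and sending the $j$th smallest to its $j$th leftmost child. Chips $0,\dots,k^n-1$ start at the root and are written in $n$-digit $k$-ary expansion (leading zeros allowed). For $w=w_1\dots w_n\in S_n$, the strategy $F_w$ fires, for each $i\in[n]$, each vertex $v$ on layer $i$ so that all chips on $v$ whose $w_i$th most significant digit equals $j$ go to the $(j+1)$th leftmost child of $v$ ($j=0,\dots,k-1$). $\mathcal{C}_{k,n,w}$ denotes the resulting stable configuration, written as the sequence of chips on layer $n+1$ read left to right (a permutation of $0,\dots,k^n-1$). For $w\in S_n$, $B(w)\in S_n$ is defined by $B(w)_i=n+1-w_{n+1-i}$ (reverse $w$, then subtract each entry from $n+1$). Sequences of equal length are compared lexicographically. -}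

module Defs where

open import Data.Nat using (ℕ; zero; suc; _+_; _*_; _∸_; _^_; _<_; _≟_)
open import Data.Nat.DivMod using (_/_; _%_)
open import Data.Fin using (Fin; toℕ)
open import Data.Fin.Permutation using (Permutation′; _⟨$⟩ʳ_)
open import Data.List using (List; []; _∷_; map; upTo; allFin; reverse; filter; sum; zip)
open import Data.List.Relation.Binary.Lex.Strict using (Lex-<)
open import Relation.Binary.PropositionalEquality using (_≡_)

-- Division / remainder by a divisor that may be 0 (only used with k ≥ 2,
-- where the divisor k or k^m is nonzero; the zero case is a junk value).
_/′_ : ℕ → ℕ → ℕ
a /′ zero  = 0
a /′ suc m = a / suc m

_%′_ : ℕ → ℕ → ℕ
a %′ zero  = 0
a %′ suc m = a % suc m

_<lex_ : List ℕ → List ℕ → Set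
_<lex_ = Lex-< _≡_ _<_

-- S_n as permutations of Fin n; the one-line notation w_1 … w_n with
-- values in {1,…,n}:  w_i = 1 + toℕ (w ⟨$⟩ʳ (i-1)).
oneLine : ∀ {n} → Permutation′ n → List ℕ
oneLine w = map (λ i → suc (toℕ (w ⟨$⟩ʳ i))) (allFin _)

-- B(w)_i = n+1 - w_{n+1-i}  (reverse w, then subtract each entry from n+1).
B : ∀ {n} → Permutation′ n → List ℕ
B {n} w = map (λ x → suc n ∸ x) (reverse (oneLine w))

-- The j-th most significant digit (j ∈ {1,…,n}) of c in its n-digit
-- base-k expansion (leading zeros allowed).
digit : (k n c j : ℕ) → ℕ
digit k n c j = (c /′ (k ^ (n ∸ j))) %′ k

-- Under F_w, at layer i (i = 1,…,n) chip c is sent to child number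
-- digit_{w_i}(c) (0-indexed from the left).  Hence chip c ends at the
-- layer-(n+1) vertex reached by the child-index path
--   (digit_{w_1}(c), …, digit_{w_n}(c)).
path : (k n : ℕ) → Permutation′ n → ℕ → List ℕ
path k n w c = map (digit k n c) (oneLine w)

-- Left-to-right position (0-indexed) on layer n+1 of the vertex reached from
-- the root by the child-index path (a_1,…,a_n): Σ a_i k^{n-i}.
leafPos : (k : ℕ) → List ℕ → ℕ
leafPos k []       = 0
leafPos k (a ∷ as) = a * k ^ Data.List.length as + leafPos k as
  where import Data.List

chipsAt : (k n : ℕ) → Permutation′ n → ℕ → List ℕ
chipsAt k n w p = filter (λ c → leafPos k (path k n w c) ≟ p) (upTo (k ^ n))

-- 𝒞_{k,n,w}: the chips on layer n+1 read left to right (one chip per vertex).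
config : (k n : ℕ) → Permutation′ n → List ℕ
config k n w = concatMap (chipsAt k n w) (upTo (k ^ n))
  where open Data.List using (concatMap)

-- Under F_w a chip with base-k digits c₁ … cₙ goes at layer i to child c_{wᵢ}, so it ends
-- on the leaf whose position has digits c_{w₁} … c_{wₙ}: leaf p carries the chip
-- Σᵢ pᵢ k^(n-wᵢ). Hence 𝒞_{k,n,w} lists the weighted digit sums Σᵢ pᵢ uᵢ, uᵢ = k^(n-wᵢ),
-- over all digit strings p in lexicographic order. Two such lists compare like the reversed
-- weight sequences: the block with p₁ = 0 is the list for (u₂, …, uₙ), and when those blocks
-- agree the block with p₁ = 1 (this needs k ≥ 2) starts with u₁ instead of u′₁.
-- Finally uₙ₊₁₋ⱼ = k^(B(w)ⱼ - 1), and k^_ is increasing.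

{-# OPTIONS --safe #-}
module Submission where

open import Defs
open import Data.Fin using (Fin; zero; suc; toℕ)
open import Data.Fin.Permutation using (Permutation′; _⟨$⟩ʳ_; _⟨$⟩ˡ_; inverseˡ; inverseʳ)
open import Data.Fin.Properties using (toℕ<n)
open import Data.List
  using (List; []; _∷_; _++_; length; map; reverse; concat; concatMap; applyUpTo; tabulate;
         filter; upTo; allFin)
open import Data.List.Properties
  using (length-++; length-map; length-reverse; length-tabulate; map-id; map-∘; map-tabulate;
         map-applyUpTo; map-upTo; map-cong-local; upTo-∷ʳ; unfold-reverse; reverse-injective;
         reverse-map; concat-map-[_]; filter-++; filter-accept; filter-reject; filter-none)
open import Data.List.Relation.Binary.Lex.Core using (this; next; halt; base)
open import Data.List.Relation.Binary.Lex.Strict using (<-compare; <-irreflexive; <-asymmetric)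
open import Data.List.Relation.Binary.Pointwise using (Pointwise-≡⇒≡; ≡⇒Pointwise-≡)
open import Data.List.Relation.Unary.All as All using (All)
open import Data.List.Relation.Unary.All.Properties using (applyUpTo⁺₁; map⁺; tabulate⁺)
open import Data.Nat using (ℕ; zero; suc; _+_; _*_; _^_; _∸_; _<_; _≤_; _≟_; s≤s; z<s; NonZero)
open import Data.Nat.DivMod
  using (_/_; _%_; m%n<n; m<n⇒m%n≡m; m<n⇒m/n≡0; m*n/n≡m; +-distrib-/-∣ˡ; %-remove-+ˡ;
         m≡m%n+[m/n]*n; m<n*o⇒m/o<n)
open import Data.Nat.Divisibility using (n∣m*n)
open import Data.Nat.Properties
open import Algebra.Properties.CommutativeMonoid.Sum +-0-commutativeMonoid
  using (sum; sum-cong-≗; sum-permute)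
open import Data.Product using (_×_; _,_; ∃-syntax)
open import Data.Sum using (_⊎_; inj₁; inj₂)
open import Function using (_∘_)
open import Function.Bundles using (_⇔_; mk⇔)
open import Function.Construct.Symmetry using (⇔-sym)
open import Function.Related.Propositional using (module EquationalReasoning; equivalence)
open import Level using (0ℓ)
open import Relation.Binary.Definitions using (Tri; tri<; tri≈; tri>; Trichotomous)
open import Relation.Binary.PropositionalEquality
open import Relation.Nullary using (¬_; contradiction)
open import Relation.Unary using (Pred; Decidable)

-- Lexicographic order

<lex-irrefl : ∀ {xs} → ¬ (xs <lex xs)
<lex-irrefl = <-irreflexive <-irrefl (≡⇒Pointwise-≡ refl)

<lex-asym : ∀ {xs ys} → xs <lex ys → ¬ (ys <lex xs)
<lex-asym = <-asymmetric sym <-resp₂-≡ <-asym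

<lex-cmp : Trichotomous _≡_ _<lex_
<lex-cmp xs ys with <-compare sym <-cmp xs ys
... | tri< a ¬b ¬c = tri< a (¬b ∘ ≡⇒Pointwise-≡) ¬c
... | tri≈ ¬a b ¬c = tri≈ ¬a (Pointwise-≡⇒≡ b) ¬c
... | tri> ¬a ¬b c = tri> ¬a (¬b ∘ ≡⇒Pointwise-≡) c

strictMono⇒⇔ : ∀ {A : Set} {_⊏_ : A → A → Set} (f : A → List ℕ) {x y : A} →
  Tri (x ⊏ y) (x ≡ y) (y ⊏ x) →
  (x ⊏ y → f x <lex f y) → (y ⊏ x → f y <lex f x) → x ⊏ y ⇔ f x <lex f y
strictMono⇒⇔ f (tri< x⊏y _ _) mono _ = mk⇔ mono (λ _ → x⊏y)
strictMono⇒⇔ f (tri≈ _ refl _) mono _ = mk⇔ mono (λ fx<fx → contradiction fx<fx <lex-irrefl)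
strictMono⇒⇔ f (tri> _ _ y⊏x) mono mono′ =
  mk⇔ mono (λ fx<fy → contradiction (mono′ y⊏x) (<lex-asym fx<fy))

map-<lex : ∀ {f : ℕ → ℕ} → (∀ {x y} → x < y → f x < f y) →
  ∀ {xs ys} → xs <lex ys → map f xs <lex map f ys
map-<lex f-mono halt = halt
map-<lex f-mono (this x<y) = this (f-mono x<y)
map-<lex f-mono (next refl xs<ys) = next refl (map-<lex f-mono xs<ys)

map-<lex-⇔ : ∀ {f : ℕ → ℕ} → (∀ {x y} → x < y → f x < f y) →
  ∀ xs ys → xs <lex ys ⇔ map f xs <lex map f ys
map-<lex-⇔ {f} f-mono xs ys =
  strictMono⇒⇔ {_⊏_ = _<lex_} (map f) (<lex-cmp xs ys) (map-<lex f-mono) (map-<lex f-mono)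

++-<lex-prefix : ∀ zs {xs ys} → xs <lex ys → (zs ++ xs) <lex (zs ++ ys)
++-<lex-prefix [] xs<ys = xs<ys
++-<lex-prefix (z ∷ zs) xs<ys = next refl (++-<lex-prefix zs xs<ys)

++-<lex : ∀ {xs ys} xs′ ys′ → length xs ≡ length ys → xs <lex ys →
  (xs ++ xs′) <lex (ys ++ ys′)
++-<lex xs′ ys′ () halt
++-<lex xs′ ys′ _ (this x<y) = this x<y
++-<lex xs′ ys′ |xs|≡|ys| (next x≡y xs<ys) =
  next x≡y (++-<lex xs′ ys′ (suc-injective |xs|≡|ys|) xs<ys)

++-<lex⁻ : ∀ xs ys {xs′ ys′} → length xs ≡ length ys → (xs ++ xs′) <lex (ys ++ ys′) →
  xs <lex ys ⊎ (xs ≡ ys × xs′ <lex ys′)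
++-<lex⁻ [] [] _ xs′<ys′ = inj₂ (refl , xs′<ys′)
++-<lex⁻ (x ∷ xs) (y ∷ ys) _ (this x<y) = inj₁ (this x<y)
++-<lex⁻ (x ∷ xs) (y ∷ ys) |xs|≡|ys| (next refl xs<ys)
  with ++-<lex⁻ xs ys (suc-injective |xs|≡|ys|) xs<ys
... | inj₁ xs<ys′ = inj₁ (next refl xs<ys′)
... | inj₂ (refl , xs′<ys′) = inj₂ (refl , xs′<ys′)

reverse-∷-<lex⁻ : ∀ {u v us vs} → length us ≡ length vs →
  reverse (u ∷ us) <lex reverse (v ∷ vs) → reverse us <lex reverse vs ⊎ (us ≡ vs × u < v)
reverse-∷-<lex⁻ {u} {v} {us} {vs} |us|≡|vs| rev<rev
  with ++-<lex⁻ (reverse us) (reverse vs) |rus|≡|rvs|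
         (subst₂ _<lex_ (unfold-reverse u us) (unfold-reverse v vs) rev<rev)
  where
  |rus|≡|rvs| : length (reverse us) ≡ length (reverse vs)
  |rus|≡|rvs| = trans (length-reverse us) (trans |us|≡|vs| (sym (length-reverse vs)))
... | inj₁ rus<rvs = inj₁ rus<rvs
... | inj₂ (rus≡rvs , this u<v) = inj₂ (reverse-injective rus≡rvs , u<v)
... | inj₂ (_ , next _ (base ()))

reverse-<lex-cmp : ∀ xs ys →
  Tri (reverse xs <lex reverse ys) (xs ≡ ys) (reverse ys <lex reverse xs)
reverse-<lex-cmp xs ys with <lex-cmp (reverse xs) (reverse ys)
... | tri< a ¬b ¬c = tri< a (¬b ∘ cong reverse) ¬c
... | tri≈ ¬a b ¬c = tri≈ ¬a (reverse-injective b) ¬c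
... | tri> ¬a ¬b c = tri> ¬a (¬b ∘ cong reverse) c

-- Weighted digit sums

digitSums : ℕ → List ℕ → List ℕ
digitSums k [] = 0 ∷ []
digitSums k (u ∷ us) = concat (applyUpTo (λ a → map (a * u +_) (digitSums k us)) k)

length-concat-maps : ∀ (f : ℕ → ℕ → ℕ) xs m →
  length (concat (applyUpTo (λ a → map (f a) xs) m)) ≡ m * length xs
length-concat-maps f xs zero = refl
length-concat-maps f xs (suc m) =
  trans (length-++ (map (f 0) xs))
        (cong₂ _+_ (length-map (f 0) xs) (length-concat-maps (f ∘ suc) xs m))

length-digitSums : ∀ k us → length (digitSums k us) ≡ k ^ length us
length-digitSums k [] = refl
length-digitSums k (u ∷ us) =
  trans (length-concat-maps (λ a → a * u +_) (digitSums k us) k)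
        (cong (k *_) (length-digitSums k us))

digitSums-head : ∀ {k} .{{_ : NonZero k}} us → ∃[ D ] digitSums k us ≡ 0 ∷ D
digitSums-head {suc k} [] = [] , refl
digitSums-head {suc k} (u ∷ us) with digitSums-head {suc k} us
... | D , ds≡0∷D rewrite ds≡0∷D = _ , refl

digitSums-mono : ∀ {k} → 1 < k → ∀ {us vs} → length us ≡ length vs →
  reverse us <lex reverse vs → digitSums k us <lex digitSums k vs
digitSums-mono _ {[]} {[]} _ (base ())
digitSums-mono {k} 1<k@(s≤s (s≤s _)) {u ∷ us} {v ∷ vs} |u∷us|≡|v∷vs| rev<rev
  with suc-injective |u∷us|≡|v∷vs|
... | |us|≡|vs| with reverse-∷-<lex⁻ {u} {v} {us} {vs} |us|≡|vs| rev<rev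
...   | inj₁ rus<rvs =
  ++-<lex _ _ |D|≡|E| (subst₂ _<lex_ (sym (map-id _)) (sym (map-id _))
                        (digitSums-mono 1<k {us} {vs} |us|≡|vs| rus<rvs))
  where
  open ≡-Reasoning
  |D|≡|E| : length (map (λ x → x) (digitSums k us)) ≡ length (map (λ x → x) (digitSums k vs))
  |D|≡|E| = begin
    length (map (λ x → x) (digitSums k us)) ≡⟨ length-map _ (digitSums k us) ⟩
    length (digitSums k us)                 ≡⟨ length-digitSums k us ⟩
    k ^ length us                           ≡⟨ cong (k ^_) |us|≡|vs| ⟩
    k ^ length vs                           ≡⟨ length-digitSums k vs ⟨
    length (digitSums k vs)                 ≡⟨ length-map _ (digitSums k vs) ⟨
    length (map (λ x → x) (digitSums k vs)) ∎
...   | inj₂ (refl , u<v) with digitSums-head {k} us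
...     | D , ds≡0∷D rewrite ds≡0∷D =
  ++-<lex-prefix (0 ∷ map (λ x → x) D) (this (+-monoˡ-< 0 (*-monoʳ-< 1 u<v)))

digitSums-<lex-⇔ : ∀ {k} → 1 < k → ∀ us vs → length us ≡ length vs →
  reverse us <lex reverse vs ⇔ digitSums k us <lex digitSums k vs
digitSums-<lex-⇔ 1<k us vs |us|≡|vs| =
  strictMono⇒⇔ {_⊏_ = λ xs ys → reverse xs <lex reverse ys} (digitSums _)
    (reverse-<lex-cmp us vs) (digitSums-mono 1<k {us} {vs} |us|≡|vs|)
    (digitSums-mono 1<k {vs} {us} (sym |us|≡|vs|))

applyUpTo-cong : ∀ {A : Set} {f g : ℕ → A} n → (∀ {i} → i < n → f i ≡ g i) →
  applyUpTo f n ≡ applyUpTo g n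
applyUpTo-cong zero _ = refl
applyUpTo-cong (suc n) f≗g = cong₂ _∷_ (f≗g z<s) (applyUpTo-cong n (f≗g ∘ s≤s))

applyUpTo-+ : ∀ {A : Set} (f : ℕ → A) m n →
  applyUpTo f (m + n) ≡ applyUpTo f m ++ applyUpTo (λ i → f (m + i)) n
applyUpTo-+ f zero n = refl
applyUpTo-+ f (suc m) n = cong (f zero ∷_) (applyUpTo-+ (f ∘ suc) m n)

applyUpTo-* : ∀ {A : Set} (f : ℕ → A) m n →
  applyUpTo f (m * n) ≡ concat (applyUpTo (λ a → applyUpTo (λ r → f (a * n + r)) n) m)
applyUpTo-* f zero n = refl
applyUpTo-* f (suc m) n = begin
  applyUpTo f (n + m * n)
    ≡⟨ applyUpTo-+ f n (m * n) ⟩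
  applyUpTo f n ++ applyUpTo (λ i → f (n + i)) (m * n)
    ≡⟨ cong (applyUpTo f n ++_) (applyUpTo-* (λ i → f (n + i)) m n) ⟩
  applyUpTo f n ++ concat (applyUpTo (λ a → applyUpTo (λ r → f (n + (a * n + r))) n) m)
    ≡⟨ cong (λ xss → applyUpTo f n ++ concat xss)
         (applyUpTo-cong m (λ _ → applyUpTo-cong n (λ {r} _ → cong f (+-assoc n _ r)))) ⟨
  applyUpTo f n ++ concat (applyUpTo (λ a → applyUpTo (λ r → f (n + a * n + r)) n) m)
    ∎
  where open ≡-Reasoning

filter-upTo-unique : ∀ {P : Pred ℕ 0ℓ} (P? : Decidable P) {n t} → t < n → P t →
  (∀ {c} → c < n → P c → c ≡ t) → filter P? (upTo n) ≡ t ∷ []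
filter-upTo-unique P? {suc n} {t} t<1+n Pt unique = begin
  filter P? (upTo (suc n))                 ≡⟨ cong (filter P?) (upTo-∷ʳ n) ⟨
  filter P? (upTo n ++ n ∷ [])             ≡⟨ filter-++ P? (upTo n) (n ∷ []) ⟩
  filter P? (upTo n) ++ filter P? (n ∷ []) ≡⟨ split (m<1+n⇒m<n∨m≡n t<1+n) ⟩
  t ∷ []                                   ∎
  where
  open ≡-Reasoning
  split : t < n ⊎ t ≡ n → filter P? (upTo n) ++ filter P? (n ∷ []) ≡ t ∷ []
  split (inj₁ t<n) =
    cong₂ _++_ (filter-upTo-unique P? t<n Pt (unique ∘ m<n⇒m<1+n))
               (filter-reject P? (λ Pn → <-irrefl (sym (unique ≤-refl Pn)) t<n))
  split (inj₂ refl) =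
    cong₂ _++_ (filter-none P? (applyUpTo⁺₁ _ n (λ c<n Pc →
                 <-irrefl (unique (m<n⇒m<1+n c<n) Pc) c<n)))
               (filter-accept P? Pt)

concatMap-fibres : ∀ {n} (σ τ : ℕ → ℕ) → (∀ {p} → p < n → τ p < n) →
  (∀ {p} → p < n → σ (τ p) ≡ p) → (∀ {c} → c < n → τ (σ c) ≡ c) →
  concatMap (λ p → filter (λ c → σ c ≟ p) (upTo n)) (upTo n) ≡ map τ (upTo n)
concatMap-fibres {n} σ τ τ< στ τσ = begin
  concat (map (λ p → filter (λ c → σ c ≟ p) (upTo n)) (upTo n))
    ≡⟨ cong concat (map-cong-local (applyUpTo⁺₁ _ n fibre)) ⟩
  concat (map (λ p → τ p ∷ []) (upTo n))
    ≡⟨ cong concat (map-∘ (upTo n)) ⟩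
  concat (map (_∷ []) (map τ (upTo n)))
    ≡⟨ concat-map-[_] (map τ (upTo n)) ⟩
  map τ (upTo n)
    ∎
  where
  open ≡-Reasoning
  fibre : ∀ {p} → p < n → filter (λ c → σ c ≟ p) (upTo n) ≡ τ p ∷ []
  fibre p<n = filter-upTo-unique (λ c → σ c ≟ _) (τ< p<n) (στ p<n)
                (λ c<n σc≡p → trans (sym (τσ c<n)) (cong τ σc≡p))

oneLine-tabulate : ∀ {n} (w : Permutation′ n) →
  oneLine w ≡ tabulate (λ i → suc (toℕ (w ⟨$⟩ʳ i)))
oneLine-tabulate w = map-tabulate (λ i → i) _

exponents : ∀ {n} → Permutation′ n → List ℕ
exponents {n} w = map (n ∸_) (oneLine w)

length-exponents : ∀ {n} (w : Permutation′ n) → length (exponents w) ≡ n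
length-exponents {n} w =
  trans (length-map _ (oneLine w)) (trans (length-map _ (allFin n)) (length-tabulate _))

B≡map-suc : ∀ {n} (w : Permutation′ n) → B w ≡ map suc (reverse (exponents w))
B≡map-suc {n} w = begin
  map (suc n ∸_) (reverse (oneLine w))
    ≡⟨ reverse-map _ (oneLine w) ⟩
  reverse (map (suc n ∸_) (oneLine w))
    ≡⟨ cong reverse (map-cong-local (All.map (+-∸-assoc 1) oneLine≤n)) ⟩
  reverse (map (λ x → suc (n ∸ x)) (oneLine w))
    ≡⟨ cong reverse (map-∘ (oneLine w)) ⟩
  reverse (map suc (exponents w))
    ≡⟨ reverse-map suc (exponents w) ⟨
  map suc (reverse (exponents w))
    ∎
  where
  open ≡-Reasoning
  oneLine≤n : All (_≤ n) (oneLine w)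
  oneLine≤n = map⁺ (tabulate⁺ (λ i → toℕ<n (w ⟨$⟩ʳ i)))

-- Base-k digits

/′≡/ : ∀ a m .{{_ : NonZero m}} → a /′ m ≡ a / m
/′≡/ a (suc m) = refl

%′≡% : ∀ a m .{{_ : NonZero m}} → a %′ m ≡ a % m
%′≡% a (suc m) = refl

infix 7 _·_
_·_ : ∀ {n} → (Fin n → ℕ) → (Fin n → ℕ) → ℕ
f · u = sum (λ i → f i * u i)

·-congˡ : ∀ {n} {f g : Fin n → ℕ} u → (∀ i → f i ≡ g i) → f · u ≡ g · u
·-congˡ u f≗g = sum-cong-≗ (λ i → cong (_* u i) (f≗g i))

·-permute : ∀ {n} (π : Permutation′ n) (f u : Fin n → ℕ) →
  (f ∘ (π ⟨$⟩ˡ_)) · u ≡ f · (u ∘ (π ⟨$⟩ʳ_))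
·-permute π f u =
  trans (sum-permute (λ j → f (π ⟨$⟩ˡ j) * u j) π)
        (sum-cong-≗ (λ i → cong (λ j → f j * u (π ⟨$⟩ʳ i)) (inverseˡ π)))

[a*d+r]<k*d : ∀ {a r k d} → a < k → r < d → a * d + r < k * d
[a*d+r]<k*d {a} {r} {k} {d} a<k r<d = begin-strict
  a * d + r <⟨ +-monoʳ-< (a * d) r<d ⟩
  a * d + d ≡⟨ +-comm (a * d) d ⟩
  suc a * d ≤⟨ *-monoˡ-≤ d a<k ⟩
  k * d     ∎
  where open ≤-Reasoning

[q*k*d+r]/d%k≡r/d%k : ∀ q r k d .{{_ : NonZero k}} .{{_ : NonZero d}} →
  (q * k * d + r) / d % k ≡ r / d % k
[q*k*d+r]/d%k≡r/d%k q r k d = begin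
  (q * k * d + r) / d % k     ≡⟨ cong (_% k) (+-distrib-/-∣ˡ r (n∣m*n (q * k))) ⟩
  (q * k * d / d + r / d) % k ≡⟨ cong (λ x → (x + r / d) % k) (m*n/n≡m (q * k) d) ⟩
  (q * k + r / d) % k         ≡⟨ %-remove-+ˡ (r / d) (n∣m*n q) ⟩
  r / d % k                   ∎
  where open ≡-Reasoning

[a*d+r]/d%k≡a : ∀ {a r} k d .{{_ : NonZero k}} .{{_ : NonZero d}} → a < k → r < d →
  (a * d + r) / d % k ≡ a
[a*d+r]/d%k≡a {a} {r} k d a<k r<d = begin
  (a * d + r) / d % k     ≡⟨ cong (_% k) (+-distrib-/-∣ˡ r (n∣m*n a)) ⟩
  (a * d / d + r / d) % k ≡⟨ cong₂ (λ x y → (x + y) % k) (m*n/n≡m a d) (m<n⇒m/n≡0 r<d) ⟩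
  (a + 0) % k             ≡⟨ cong (_% k) (+-identityʳ a) ⟩
  a % k                   ≡⟨ m<n⇒m%n≡m a<k ⟩
  a                       ∎
  where open ≡-Reasoning

module _ (k : ℕ) .{{_ : NonZero k}} where

  -- Instance search cannot solve NonZero (k ^ t) (it would have to invert _^_), so the
  -- needed instances are declared locally.
  k^≢0 : ∀ t → NonZero (k ^ t)
  k^≢0 t = m^n≢0 k t

  placeValue : ∀ {n} → Fin n → ℕ
  placeValue {n} i = k ^ (n ∸ suc (toℕ i))

  digits : ∀ n → ℕ → Fin n → ℕ
  digits n c i = c / placeValue i % k
    where instance _ = k^≢0 (n ∸ suc (toℕ i))

  fromDigits : ∀ {n} → (Fin n → ℕ) → ℕ
  fromDigits f = f · placeValue

  digits-< : ∀ n c i → digits n c i < k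
  digits-< n c i = m%n<n _ k

  fromDigits-cong : ∀ {n} {f g : Fin n → ℕ} → (∀ i → f i ≡ g i) →
    fromDigits f ≡ fromDigits g
  fromDigits-cong = ·-congˡ placeValue

  fromDigits-< : ∀ {n} (f : Fin n → ℕ) → (∀ i → f i < k) → fromDigits f < k ^ n
  fromDigits-< {zero} f f<k = z<s
  fromDigits-< {suc n} f f<k = [a*d+r]<k*d (f<k zero) (fromDigits-< (f ∘ suc) (f<k ∘ suc))

  digits-[a*k^m+r]-zero : ∀ m {a r} → a < k → r < k ^ m →
    digits (suc m) (a * k ^ m + r) zero ≡ a
  digits-[a*k^m+r]-zero m = [a*d+r]/d%k≡a k (k ^ m)
    where instance _ = k^≢0 m

  digits-[a*k^m+r] : ∀ m a r (j : Fin m) → digits m (a * k ^ m + r) j ≡ digits m r j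
  digits-[a*k^m+r] m a r j =
    trans (cong (λ x → (x + r) / k ^ t % k) a*k^m≡)
          ([q*k*d+r]/d%k≡r/d%k (a * k ^ s) r k (k ^ t))
    where
    s = toℕ j
    t = m ∸ suc s
    instance _ = k^≢0 t
    a*k^m≡ : a * k ^ m ≡ a * k ^ s * k * k ^ t
    a*k^m≡ = begin
      a * k ^ m               ≡⟨ cong (λ e → a * k ^ e) (m+[n∸m]≡n (toℕ<n j)) ⟨
      a * k ^ (suc s + t)     ≡⟨ cong (a *_) (^-distribˡ-+-* k (suc s) t) ⟩
      a * (k * k ^ s * k ^ t) ≡⟨ *-assoc a _ _ ⟨
      a * (k * k ^ s) * k ^ t ≡⟨ cong (λ x → a * x * k ^ t) (*-comm k (k ^ s)) ⟩
      a * (k ^ s * k) * k ^ t ≡⟨ cong (_* k ^ t) (*-assoc a (k ^ s) k) ⟨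
      a * k ^ s * k * k ^ t   ∎
      where open ≡-Reasoning

  digits-fromDigits : ∀ {n} (f : Fin n → ℕ) → (∀ i → f i < k) →
    ∀ i → digits n (fromDigits f) i ≡ f i
  digits-fromDigits {suc n} f f<k zero =
    digits-[a*k^m+r]-zero n (f<k zero) (fromDigits-< (f ∘ suc) (f<k ∘ suc))
  digits-fromDigits {suc n} f f<k (suc j) =
    trans (digits-[a*k^m+r] n (f zero) (fromDigits (f ∘ suc)) j)
          (digits-fromDigits (f ∘ suc) (f<k ∘ suc) j)

  fromDigits-digits : ∀ {n c} → c < k ^ n → fromDigits (digits n c) ≡ c
  fromDigits-digits {zero} {zero} _ = refl
  fromDigits-digits {zero} {suc c} (s≤s ())
  fromDigits-digits {suc n} {c} c<k^[1+n] = begin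
    fromDigits (digits (suc n) c)
      ≡⟨ cong (fromDigits ∘ digits (suc n)) c≡ ⟩
    fromDigits (digits (suc n) (a * k ^ n + r))
      ≡⟨ cong₂ (λ x y → x * k ^ n + y) (digits-[a*k^m+r]-zero n a<k r<k^n)
               (trans (fromDigits-cong (digits-[a*k^m+r] n a r)) (fromDigits-digits {n} r<k^n)) ⟩
    a * k ^ n + r
      ≡⟨ c≡ ⟨
    c ∎
    where
    open ≡-Reasoning
    instance _ = k^≢0 n
    a = c / k ^ n
    r = c % k ^ n
    c≡ : c ≡ a * k ^ n + r
    c≡ = trans (m≡m%n+[m/n]*n c (k ^ n)) (+-comm r (a * k ^ n))
    a<k : a < k
    a<k = m<n*o⇒m/o<n c<k^[1+n]
    r<k^n : r < k ^ n
    r<k^n = m%n<n c (k ^ n)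

  permuteDigits : ∀ {n} → (Fin n → Fin n) → ℕ → ℕ
  permuteDigits {n} π c = fromDigits (digits n c ∘ π)

  permuteDigits-< : ∀ {n} (π : Fin n → Fin n) c → permuteDigits π c < k ^ n
  permuteDigits-< {n} π c = fromDigits-< _ (λ i → digits-< n c (π i))

  permuteDigits-inverse : ∀ {n} {π ρ : Fin n → Fin n} → (∀ i → ρ (π i) ≡ i) →
    ∀ {c} → c < k ^ n → permuteDigits π (permuteDigits ρ c) ≡ c
  permuteDigits-inverse {n} {π} {ρ} ρπ≗id {c} c<k^n = begin
    fromDigits (digits n (fromDigits (digits n c ∘ ρ)) ∘ π)
      ≡⟨ fromDigits-cong (λ i → digits-fromDigits _ (λ j → digits-< n c (ρ j)) (π i)) ⟩
    fromDigits (digits n c ∘ ρ ∘ π)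
      ≡⟨ fromDigits-cong (λ i → cong (digits n c) (ρπ≗id i)) ⟩
    fromDigits (digits n c)
      ≡⟨ fromDigits-digits {n} c<k^n ⟩
    c ∎
    where open ≡-Reasoning

  digitSums-tabulate : ∀ {m} (u : Fin m → ℕ) →
    digitSums k (tabulate u) ≡ applyUpTo (λ p → digits m p · u) (k ^ m)
  digitSums-tabulate {zero} u = refl
  digitSums-tabulate {suc m} u = begin
    concat (applyUpTo (λ a → map (a * u zero +_) (digitSums k (tabulate (u ∘ suc)))) k)
      ≡⟨ cong (λ D → concat (applyUpTo (λ a → map (a * u zero +_) D) k))
              (digitSums-tabulate (u ∘ suc)) ⟩
    concat (applyUpTo (λ a → map (a * u zero +_)
                                 (applyUpTo (λ r → digits m r · (u ∘ suc)) (k ^ m))) k)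
      ≡⟨ cong concat (applyUpTo-cong k block≡) ⟩
    concat (applyUpTo (λ a → applyUpTo (λ r → digits (suc m) (a * k ^ m + r) · u) (k ^ m)) k)
      ≡⟨ applyUpTo-* (λ p → digits (suc m) p · u) k (k ^ m) ⟨
    applyUpTo (λ p → digits (suc m) p · u) (k ^ suc m)
      ∎
    where
    open ≡-Reasoning
    block≡ : ∀ {a} → a < k →
      map (a * u zero +_) (applyUpTo (λ r → digits m r · (u ∘ suc)) (k ^ m)) ≡
      applyUpTo (λ r → digits (suc m) (a * k ^ m + r) · u) (k ^ m)
    block≡ {a} a<k = trans (map-applyUpTo _ _ (k ^ m)) (applyUpTo-cong (k ^ m) (λ {r} r<k^m →
      sym (cong₂ (λ x y → x * u zero + y) (digits-[a*k^m+r]-zero m a<k r<k^m)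
                                           (·-congˡ (u ∘ suc) (digits-[a*k^m+r] m a r)))))

  -- The stable configuration

  leafPos-tabulate : ∀ {n} (f : Fin n → ℕ) → leafPos k (tabulate f) ≡ fromDigits f
  leafPos-tabulate {zero} f = refl
  leafPos-tabulate {suc n} f =
    cong₂ (λ e v → f zero * k ^ e + v) (length-tabulate (f ∘ suc)) (leafPos-tabulate (f ∘ suc))

  digit≡digits : ∀ n c (i : Fin n) → digit k n c (suc (toℕ i)) ≡ digits n c i
  digit≡digits n c i = trans (cong (_%′ k) (/′≡/ c (placeValue i))) (%′≡% _ k)
    where instance _ = k^≢0 (n ∸ suc (toℕ i))

  leafPos-path : ∀ {n} (w : Permutation′ n) c →
    leafPos k (path k n w c) ≡ permuteDigits (w ⟨$⟩ʳ_) c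
  leafPos-path {n} w c = begin
    leafPos k (map (digit k n c) (oneLine w))
      ≡⟨ cong (leafPos k ∘ map (digit k n c)) (oneLine-tabulate w) ⟩
    leafPos k (map (digit k n c) (tabulate (λ i → suc (toℕ (w ⟨$⟩ʳ i)))))
      ≡⟨ cong (leafPos k) (map-tabulate (λ i → suc (toℕ (w ⟨$⟩ʳ i))) (digit k n c)) ⟩
    leafPos k (tabulate (λ i → digit k n c (suc (toℕ (w ⟨$⟩ʳ i)))))
      ≡⟨ leafPos-tabulate (λ i → digit k n c (suc (toℕ (w ⟨$⟩ʳ i)))) ⟩
    fromDigits (λ i → digit k n c (suc (toℕ (w ⟨$⟩ʳ i))))
      ≡⟨ fromDigits-cong (λ i → digit≡digits n c (w ⟨$⟩ʳ i)) ⟩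
    permuteDigits (w ⟨$⟩ʳ_) c
      ∎
    where open ≡-Reasoning

  config≡map-permuteDigits : ∀ {n} (w : Permutation′ n) →
    config k n w ≡ map (permuteDigits (w ⟨$⟩ˡ_)) (upTo (k ^ n))
  config≡map-permuteDigits {n} w =
    concatMap-fibres (λ c → leafPos k (path k n w c)) (permuteDigits (w ⟨$⟩ˡ_))
      (λ {p} _ → permuteDigits-< (w ⟨$⟩ˡ_) p)
      (λ {p} p<k^n → trans (leafPos-path w _) (permuteDigits-inverse (λ _ → inverseˡ w) p<k^n))
      (λ {c} c<k^n → trans (cong (permuteDigits (w ⟨$⟩ˡ_)) (leafPos-path w c))
                           (permuteDigits-inverse (λ _ → inverseʳ w) c<k^n))

  config≡digitSums : ∀ {n} (w : Permutation′ n) →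
    config k n w ≡ digitSums k (map (k ^_) (exponents w))
  config≡digitSums {n} w = begin
    config k n w
      ≡⟨ config≡map-permuteDigits w ⟩
    map (permuteDigits (w ⟨$⟩ˡ_)) (upTo (k ^ n))
      ≡⟨ map-upTo _ (k ^ n) ⟩
    applyUpTo (permuteDigits (w ⟨$⟩ˡ_)) (k ^ n)
      ≡⟨ applyUpTo-cong (k ^ n) (λ {p} _ → ·-permute w (digits n p) placeValue) ⟩
    applyUpTo (λ p → digits n p · (placeValue ∘ (w ⟨$⟩ʳ_))) (k ^ n)
      ≡⟨ digitSums-tabulate (placeValue ∘ (w ⟨$⟩ʳ_)) ⟨
    digitSums k (tabulate (placeValue ∘ (w ⟨$⟩ʳ_)))
      ≡⟨ cong (digitSums k)
              (map-tabulate (λ i → suc (toℕ (w ⟨$⟩ʳ i))) (λ j → k ^ (n ∸ j))) ⟨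
    digitSums k (map (λ j → k ^ (n ∸ j)) (tabulate (λ i → suc (toℕ (w ⟨$⟩ʳ i)))))
      ≡⟨ cong (digitSums k ∘ map (λ j → k ^ (n ∸ j))) (oneLine-tabulate w) ⟨
    digitSums k (map (λ j → k ^ (n ∸ j)) (oneLine w))
      ≡⟨ cong (digitSums k) (map-∘ (oneLine w)) ⟩
    digitSums k (map (k ^_) (exponents w))
      ∎
    where open ≡-Reasoning

theorem3p8 : (k n : ℕ) → 2 ≤ k → (w w′ : Permutation′ n) →
    (config k n w <lex config k n w′) ⇔ (B w <lex B w′)
theorem3p8 k n 2≤k@(s≤s _) w w′ = begin
  config k n w <lex config k n w′
    ≡⟨ cong₂ _<lex_ (config≡digitSums k w) (config≡digitSums k w′) ⟩
  digitSums k (map (k ^_) e) <lex digitSums k (map (k ^_) e′)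
    ∼⟨ ⇔-sym (digitSums-<lex-⇔ 2≤k (map (k ^_) e) (map (k ^_) e′) |e|≡|e′|) ⟩
  reverse (map (k ^_) e) <lex reverse (map (k ^_) e′)
    ≡⟨ cong₂ _<lex_ (reverse-map (k ^_) e) (reverse-map (k ^_) e′) ⟨
  map (k ^_) (reverse e) <lex map (k ^_) (reverse e′)
    ∼⟨ ⇔-sym (map-<lex-⇔ (^-monoʳ-< k 2≤k) _ _) ⟩
  reverse e <lex reverse e′
    ∼⟨ map-<lex-⇔ s≤s _ _ ⟩
  map suc (reverse e) <lex map suc (reverse e′)
    ≡⟨ cong₂ _<lex_ (B≡map-suc w) (B≡map-suc w′) ⟨
  B w <lex B w′
    ∎
  where
  open EquationalReasoning {k = equivalence}
  e = exponents w
  e′ = exponents w′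
  |e|≡|e′| : length (map (k ^_) e) ≡ length (map (k ^_) e′)
  |e|≡|e′| = trans (length-map _ e) (trans (length-exponents w)
               (sym (trans (length-map _ e′) (length-exponents w′))))
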